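{- For every integer $n \geq 1$, the independence number of the Fibonacci-run graph satisfies $\alpha(\mathcal{R}_n) \geq \left\lceil \frac{f_{n+2}}{2} \right\rceil$.
   Context: A binary string is called run-constrained if every run (maximal block) of consecutive $1$s in it is immediately followed by a run of $0$s of strictly greater length. For $n \geq 1$, the Fibonacci-run graph $\mathcal{R}_n$ has vertex set $\{ w \in \{0,1\}^n : w00 \text{ is a run-constrained string of length } n+2\}$, and two vertices are adjacent iff they differ in exactly one coordinate. Fibonacci numbers: $f_0 = 0$, $f_1 = 1$, $f_n = f_{n-1} + f_{n-2}$. $\alpha(G)$ denotes the maximum size of an independent set of vertices of $G$. -}

module Defs where

open import Data.Bool using (Bool; true; false; if_then_else_)
open import Data.Nat using (ℕ; zero; suc; _+_; _<_; _≥_; ⌈_/2⌉)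
open import Data.Product using (_×_; _,_; ∃-syntax)
open import Data.Unit using (⊤)
open import Data.Empty using (⊥)
open import Data.List using (List; []; _∷_; _++_; length)
open import Data.Vec using (Vec; toList)
import Data.Vec as V
open import Data.List.Membership.Propositional using (_∈_)
open import Data.List.Relation.Unary.All using (All)
open import Data.List.Relation.Unary.AllPairs using (AllPairs)
open import Data.List.Relation.Unary.Unique.Propositional using (Unique)
open import Relation.Binary.PropositionalEquality using (_≡_)
open import Relation.Nullary using (¬_)

fib : ℕ → ℕ
fib zero = zero
fib (suc zero) = suc zero
fib (suc (suc n)) = fib (suc n) + fib n

eqB : Bool → Bool → Bool
eqB true true = true
eqB false false = true
eqB _ _ = false

push : Bool → List (Bool × ℕ) → List (Bool × ℕ)
push b [] = (b , 1) ∷ []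
push b ((c , k) ∷ rs) = if eqB b c then (c , suc k) ∷ rs else (b , 1) ∷ (c , k) ∷ rs

runs : List Bool → List (Bool × ℕ)
runs [] = []
runs (b ∷ xs) = push b (runs xs)

RunsOK : List (Bool × ℕ) → Set
RunsOK [] = ⊤
RunsOK ((false , _) ∷ rs) = RunsOK rs
RunsOK ((true , k) ∷ []) = ⊥
RunsOK ((true , k) ∷ (b , m) ∷ rs) = (b ≡ false) × (k < m) × RunsOK ((b , m) ∷ rs)

RunConstrained : List Bool → Set
RunConstrained w = RunsOK (runs w)

IsVertex : (n : ℕ) → Vec Bool n → Set
IsVertex n w = RunConstrained (toList w ++ false ∷ false ∷ [])

hamming : {n : ℕ} → Vec Bool n → Vec Bool n → ℕ
hamming V.[] V.[] = 0
hamming (a V.∷ u) (b V.∷ v) = (if eqB a b then 0 else 1) + hamming u v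

Adjacent : {n : ℕ} → Vec Bool n → Vec Bool n → Set
Adjacent u v = hamming u v ≡ 1

IndependentSet : (n : ℕ) → List (Vec Bool n) → Set
IndependentSet n S = Unique S × All (IsVertex n) S × AllPairs (λ u v → ¬ Adjacent u v) S

αR≥ : ℕ → ℕ → Set
αR≥ n k = ∃[ S ] (IndependentSet n S × length S ≥ k)

module Submission where

-- R n sits inside the hypercube, which is bipartite by the parity of the number
-- of 1s, so one parity class of any set of vertices of R n is independent and
-- holds at least half of them.  It remains to exhibit f (n+2) distinct vertices:
-- the vertices of R (n+2) are 0w for w in R (n+1) together with 1w′ for w in R n,
-- where w′ is w with a 0 inserted after its leading run of 1s.

open import Defs
open import Data.Nat using (ℕ; zero; suc; pred; _+_; _≤_; _≥_; z≤n; s≤s; ⌈_/2⌉)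
open import Data.Nat.Properties using (⌈n/2⌉-mono; n≡⌈n+n/2⌉; ≤-total; +-monoˡ-≤; +-monoʳ-≤; +-suc; ≤-reflexive; ≤-trans)
open import Data.Bool using (Bool; true; false; not; _xor_)
import Data.Bool as Bool
open import Data.Bool.Properties using (not-injective; ¬-not)
open import Data.Product using (_×_; _,_)
open import Data.Sum using (_⊎_; inj₁; inj₂; [_,_]′)
open import Data.Unit using (tt)
open import Data.List using (List; []; _∷_; _++_; length; map; filter)
open import Data.List.Properties using (length-++; length-map)
open import Data.Vec using (Vec; toList)
import Data.Vec as V
open import Data.List.Relation.Unary.All using (All; []; _∷_)
import Data.List.Relation.Unary.All as All
open import Data.List.Relation.Unary.All.Properties using (all-filter; filter⁺; ++⁺; map⁺)
open import Data.List.Relation.Unary.AllPairs using (AllPairs; []; _∷_)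
open import Data.List.Relation.Unary.Unique.Propositional using (Unique)
import Data.List.Relation.Unary.Unique.Propositional.Properties as Unique
open import Data.List.Membership.Propositional using (_∈_)
open import Data.List.Membership.Propositional.Properties using (∈-map⁻)
open import Relation.Binary.PropositionalEquality
open import Relation.Nullary using (¬_; yes; no)
open import Relation.Unary using (Decidable)
open import Relation.Nullary.Decidable using (¬?)

⌈m+n/2⌉≤m⊎⌈m+n/2⌉≤n : ∀ m n → ⌈ m + n /2⌉ ≤ m ⊎ ⌈ m + n /2⌉ ≤ n
⌈m+n/2⌉≤m⊎⌈m+n/2⌉≤n m n with ≤-total m n
... | inj₁ m≤n = inj₂ (subst (⌈ m + n /2⌉ ≤_) (sym (n≡⌈n+n/2⌉ n)) (⌈n/2⌉-mono (+-monoˡ-≤ n m≤n)))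
... | inj₂ n≤m = inj₁ (subst (⌈ m + n /2⌉ ≤_) (sym (n≡⌈n+n/2⌉ m)) (⌈n/2⌉-mono (+-monoʳ-≤ m n≤m)))

length-filter-∁ : ∀ {A : Set} {P : A → Set} (P? : Decidable P) (xs : List A) →
                  length (filter P? xs) + length (filter (λ x → ¬? (P? x)) xs) ≡ length xs
length-filter-∁ P? [] = refl
length-filter-∁ P? (x ∷ xs) with P? x
... | yes _ = cong suc (length-filter-∁ P? xs)
... | no  _ = trans (+-suc _ _) (cong suc (length-filter-∁ P? xs))

parity : ∀ {n} → Vec Bool n → Bool
parity V.[] = false
parity (a V.∷ u) = a xor parity u

hamming≡0⇒≡ : ∀ {n} (u v : Vec Bool n) → hamming u v ≡ 0 → u ≡ v
hamming≡0⇒≡ V.[] V.[] _ = refl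
hamming≡0⇒≡ (true V.∷ u) (true V.∷ v) h = cong (true V.∷_) (hamming≡0⇒≡ u v h)
hamming≡0⇒≡ (false V.∷ u) (false V.∷ v) h = cong (false V.∷_) (hamming≡0⇒≡ u v h)

xor-≢-not-xor : ∀ a b → a xor b ≢ not a xor b
xor-≢-not-xor true true ()
xor-≢-not-xor true false ()
xor-≢-not-xor false true ()
xor-≢-not-xor false false ()

adjacent⇒parity≢ : ∀ {n} (u v : Vec Bool n) → Adjacent u v → parity u ≢ parity v
adjacent⇒parity≢ V.[] V.[] ()
adjacent⇒parity≢ (true V.∷ u) (true V.∷ v) adj p = adjacent⇒parity≢ u v adj (not-injective p)
adjacent⇒parity≢ (false V.∷ u) (false V.∷ v) adj p = adjacent⇒parity≢ u v adj p
adjacent⇒parity≢ (true V.∷ u) (false V.∷ v) adj p with hamming≡0⇒≡ u v (cong pred adj)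
... | refl = xor-≢-not-xor false (parity u) (sym p)
adjacent⇒parity≢ (false V.∷ u) (true V.∷ v) adj p with hamming≡0⇒≡ u v (cong pred adj)
... | refl = xor-≢-not-xor false (parity u) p

parityClass-nonAdjacent : ∀ {n} b (xs : List (Vec Bool n)) → All (λ x → parity x ≡ b) xs →
                          AllPairs (λ u v → ¬ Adjacent u v) xs
parityClass-nonAdjacent b [] [] = []
parityClass-nonAdjacent b (x ∷ xs) (px ∷ pxs) =
  All.map (λ {y} py adj → adjacent⇒parity≢ x y adj (trans px (sym py))) pxs
  ∷ parityClass-nonAdjacent b xs pxs

filter-independent : ∀ {n} {P : Vec Bool n → Set} (P? : Decidable P) {b} →
                     (∀ {x} → P x → parity x ≡ b) →
                     ∀ {xs} → Unique xs → All (IsVertex n) xs → IndependentSet n (filter P? xs)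
filter-independent P? {b} P⇒b {xs} uniq verts =
  Unique.filter⁺ P? uniq ,
  filter⁺ P? verts ,
  parityClass-nonAdjacent b (filter P? xs) (All.map P⇒b (all-filter P? xs))

odd? : ∀ {n} → Decidable (λ (x : Vec Bool n) → parity x ≡ true)
odd? x = parity x Bool.≟ true

αR≥⌈length/2⌉ : ∀ {n} (xs : List (Vec Bool n)) → Unique xs → All (IsVertex n) xs →
                αR≥ n ⌈ length xs /2⌉
αR≥⌈length/2⌉ xs uniq verts =
  [ (λ le → odds , filter-independent odd? (λ p → p) uniq verts , half le)
  , (λ le → evens , filter-independent (λ x → ¬? (odd? x)) ¬-not uniq verts , half le)
  ]′ (⌈m+n/2⌉≤m⊎⌈m+n/2⌉≤n (length odds) (length evens))
  where
  odds evens : List _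
  odds = filter odd? xs
  evens = filter (λ x → ¬? (odd? x)) xs
  half : ∀ {k} → ⌈ length odds + length evens /2⌉ ≤ k → ⌈ length xs /2⌉ ≤ k
  half = ≤-trans (≤-reflexive (cong ⌈_/2⌉ (sym (length-filter-∁ odd? xs))))

insertZeroAfterOnes : List Bool → List Bool
insertZeroAfterOnes [] = false ∷ []
insertZeroAfterOnes (false ∷ x) = false ∷ false ∷ x
insertZeroAfterOnes (true ∷ x) = true ∷ insertZeroAfterOnes x

insertZeroAfterOnesᵛ : ∀ {n} → Vec Bool n → Vec Bool (suc n)
insertZeroAfterOnesᵛ V.[] = false V.∷ V.[]
insertZeroAfterOnesᵛ (false V.∷ x) = false V.∷ false V.∷ x
insertZeroAfterOnesᵛ (true V.∷ x) = true V.∷ insertZeroAfterOnesᵛ x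

lengthenFirstZeroRun : List (Bool × ℕ) → List (Bool × ℕ)
lengthenFirstZeroRun [] = (false , 1) ∷ []
lengthenFirstZeroRun ((false , m) ∷ rs) = (false , suc m) ∷ rs
lengthenFirstZeroRun ((true , k) ∷ rs) = (true , k) ∷ lengthenFirstZeroRun rs

push-false-push-false : ∀ rs → push false (push false rs) ≡ lengthenFirstZeroRun (push false rs)
push-false-push-false [] = refl
push-false-push-false ((false , k) ∷ rs) = refl
push-false-push-false ((true , k) ∷ rs) = refl

push-true-lengthen : ∀ rs → push true (lengthenFirstZeroRun rs) ≡ lengthenFirstZeroRun (push true rs)
push-true-lengthen [] = refl
push-true-lengthen ((false , k) ∷ rs) = refl
push-true-lengthen ((true , k) ∷ rs) = refl

runs-insertZeroAfterOnes : ∀ w → runs (insertZeroAfterOnes w) ≡ lengthenFirstZeroRun (runs w)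
runs-insertZeroAfterOnes [] = refl
runs-insertZeroAfterOnes (false ∷ w) = push-false-push-false (runs w)
runs-insertZeroAfterOnes (true ∷ w) = begin
  push true (runs (insertZeroAfterOnes w))    ≡⟨ cong (push true) (runs-insertZeroAfterOnes w) ⟩
  push true (lengthenFirstZeroRun (runs w))   ≡⟨ push-true-lengthen (runs w) ⟩
  lengthenFirstZeroRun (push true (runs w))   ∎
  where open ≡-Reasoning

RunsOK-push-false : ∀ rs → RunsOK rs → RunsOK (push false rs)
RunsOK-push-false [] _ = tt
RunsOK-push-false ((false , k) ∷ rs) ok = ok
RunsOK-push-false ((true , k) ∷ rs) ok = ok

-- The leading 1-run and the 0-run after it both grow by one.
RunsOK-push-true-lengthen : ∀ b rs → RunsOK (push b rs) →
                            RunsOK (push true (lengthenFirstZeroRun (push b rs)))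
RunsOK-push-true-lengthen false [] _ = refl , s≤s (s≤s z≤n) , tt
RunsOK-push-true-lengthen false ((false , k) ∷ rs) ok = refl , s≤s (s≤s z≤n) , ok
RunsOK-push-true-lengthen false ((true , k) ∷ rs) ok = refl , s≤s (s≤s z≤n) , ok
RunsOK-push-true-lengthen true ((false , k) ∷ rs) (refl , k<m , ok) = refl , s≤s k<m , ok
RunsOK-push-true-lengthen true ((true , k) ∷ (false , m) ∷ rs) (refl , k<m , ok) = refl , s≤s k<m , ok

runConstrained-1∷insertZeroAfterOnes : ∀ b w → RunConstrained (b ∷ w) →
                                       RunConstrained (true ∷ insertZeroAfterOnes (b ∷ w))
runConstrained-1∷insertZeroAfterOnes b w rc =
  subst (λ rs → RunsOK (push true rs)) (sym (runs-insertZeroAfterOnes (b ∷ w)))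
        (RunsOK-push-true-lengthen b (runs w) rc)

toList-insertZeroAfterOnesᵛ : ∀ {n} (w : Vec Bool n) →
  toList (insertZeroAfterOnesᵛ w) ++ false ∷ false ∷ [] ≡ insertZeroAfterOnes (toList w ++ false ∷ false ∷ [])
toList-insertZeroAfterOnesᵛ V.[] = refl
toList-insertZeroAfterOnesᵛ (false V.∷ w) = refl
toList-insertZeroAfterOnesᵛ (true V.∷ w) = cong (true ∷_) (toList-insertZeroAfterOnesᵛ w)

isVertex-0∷ : ∀ {n} (w : Vec Bool n) → IsVertex n w → IsVertex (suc n) (false V.∷ w)
isVertex-0∷ w = RunsOK-push-false (runs (toList w ++ false ∷ false ∷ []))

isVertex-1∷insertZeroAfterOnesᵛ : ∀ {n} (w : Vec Bool n) → IsVertex n w →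
                                  IsVertex (suc (suc n)) (true V.∷ insertZeroAfterOnesᵛ w)
isVertex-1∷insertZeroAfterOnesᵛ w v =
  subst (λ u → RunConstrained (true ∷ u)) (sym (toList-insertZeroAfterOnesᵛ w)) (extend w v)
  where
  extend : ∀ {n} (w : Vec Bool n) → IsVertex n w →
           RunConstrained (true ∷ insertZeroAfterOnes (toList w ++ false ∷ false ∷ []))
  extend V.[] = runConstrained-1∷insertZeroAfterOnes false (false ∷ [])
  extend (b V.∷ w) = runConstrained-1∷insertZeroAfterOnes b (toList w ++ false ∷ false ∷ [])

insertZeroAfterOnesᵛ-injective : ∀ {n} {u v : Vec Bool n} →
                                 insertZeroAfterOnesᵛ u ≡ insertZeroAfterOnesᵛ v → u ≡ v
insertZeroAfterOnesᵛ-injective {u = V.[]} {V.[]} _ = refl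
insertZeroAfterOnesᵛ-injective {u = false V.∷ u} {false V.∷ v} refl = refl
insertZeroAfterOnesᵛ-injective {u = true V.∷ u} {true V.∷ v} e =
  cong (true V.∷_) (insertZeroAfterOnesᵛ-injective (cong V.tail e))

-- These are in fact all vertices of R n, but only soundness is needed.
vertexList : (n : ℕ) → List (Vec Bool n)
vertexList zero = V.[] ∷ []
vertexList (suc zero) = (false V.∷ V.[]) ∷ (true V.∷ V.[]) ∷ []
vertexList (suc (suc n)) = map (false V.∷_) (vertexList (suc n))
                        ++ map (λ w → true V.∷ insertZeroAfterOnesᵛ w) (vertexList n)

length-vertexList : ∀ n → length (vertexList n) ≡ fib (suc (suc n))
length-vertexList zero = refl
length-vertexList (suc zero) = refl
length-vertexList (suc (suc n)) = begin
  length (map (false V.∷_) (vertexList (suc n)) ++ map _ (vertexList n))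
    ≡⟨ length-++ (map (false V.∷_) (vertexList (suc n))) ⟩
  length (map (false V.∷_) (vertexList (suc n))) + length (map _ (vertexList n))
    ≡⟨ cong₂ _+_ (length-map _ (vertexList (suc n))) (length-map _ (vertexList n)) ⟩
  length (vertexList (suc n)) + length (vertexList n)
    ≡⟨ cong₂ _+_ (length-vertexList (suc n)) (length-vertexList n) ⟩
  fib (suc (suc (suc n))) + fib (suc (suc n)) ∎
  where open ≡-Reasoning

vertexList-isVertex : ∀ n → All (IsVertex n) (vertexList n)
vertexList-isVertex zero = tt ∷ []
vertexList-isVertex (suc zero) = tt ∷ (refl , s≤s (s≤s z≤n) , tt) ∷ []
vertexList-isVertex (suc (suc n)) =
  ++⁺ (map⁺ (All.map (λ {w} → isVertex-0∷ w) (vertexList-isVertex (suc n))))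
      (map⁺ (All.map (λ {w} → isVertex-1∷insertZeroAfterOnesᵛ w) (vertexList-isVertex n)))

vertexList-unique : ∀ n → Unique (vertexList n)
vertexList-unique zero = [] ∷ []
vertexList-unique (suc zero) = ((λ ()) ∷ []) ∷ [] ∷ []
vertexList-unique (suc (suc n)) =
  Unique.++⁺ (Unique.map⁺ (cong V.tail) (vertexList-unique (suc n)))
             (Unique.map⁺ (λ e → insertZeroAfterOnesᵛ-injective (cong V.tail e)) (vertexList-unique n))
             headsDiffer
  where
  headsDiffer : ∀ {v} → ¬ (v ∈ map (false V.∷_) (vertexList (suc n))
                           × v ∈ map (λ w → true V.∷ insertZeroAfterOnesᵛ w) (vertexList n))
  headsDiffer (v∈₀ , v∈₁) with ∈-map⁻ _ v∈₀ | ∈-map⁻ _ v∈₁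
  ... | _ , _ , refl | _ , _ , ()

lemma3p5 : (n : ℕ) → n ≥ 1 → αR≥ n ⌈ fib (suc (suc n)) /2⌉
lemma3p5 n _ = subst (λ k → αR≥ n ⌈ k /2⌉) (length-vertexList n)
                     (αR≥⌈length/2⌉ (vertexList n) (vertexList-unique n) (vertexList-isVertex n))
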